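{- For every $\epsilon\in(0,1)$ there exist constants $C,c>0$ and graphs with arbitrarily large numbers of vertices $n$ such that each such graph on $n$ vertices has edge density less than $1+Cn^{ -\epsilon}$ and Broadcast on it is unsolvable with fewer than $cn^{1-\epsilon}$ ignorant agents.
   Context: The edge density of a graph with $n$ nodes and $m$ edges is $m/n$. The Broadcast problem: a connected base graph $G=(V,E)$ is given and time proceeds in synchronous rounds. In each round the adversary first removes a (possibly empty) set $E'\subseteq E$ such that $(V,E\setminus E')$ is connected; then each agent, after local computation and communication with agents at the same node, either stays or moves along one edge of $E\setminus E'$ incident to its node; all agents move simultaneously. Agents have unique IDs, local memory, and full knowledge at every round of $G$, the current edge set, and the positions and knowledge status of all agents. Initially one source agent holding a message $\mathcal M$ and $k\ge 1$ ignorant agents are placed at distinct nodes, the placement chosen by the adversary. An ignorant agent becomes a source agent when at the same node as a source agent. Broadcast is solvable on $G$ with $k$ ignorant agents if the agents have a strategy that, for every initial placement and every adversary behavior, makes all agents source agents within finitely many rounds; otherwise it is unsolvable. -}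

module Defs where

open import Level using (0ℓ)
open import Data.Nat as ℕ using (ℕ; zero; suc; _+_; _*_; _∸_; _^_)
open import Data.Integer as ℤ using (ℤ)
open import Data.Rational as ℚ using (ℚ; ↥_; ↧ₙ_; 0ℚ; 1ℚ)
open import Data.Bool using (Bool; true; false; T; _∧_; _∨_; if_then_else_)
open import Data.Fin as Fin using (Fin; toℕ)
open import Data.List using (List; map; allFin)
open import Data.Nat.ListAction using (sum)
open import Data.Bool.ListAction using (any)
open import Data.Product using (Σ; ∃; _×_; _,_; proj₁; proj₂)
open import Data.Sum using (_⊎_)
open import Relation.Binary.PropositionalEquality using (_≡_)
open import Relation.Nullary using (¬_)
open import Relation.Nullary.Decidable using (⌊_⌋)
open import Function.Definitions using (Injective)

-- Real numbers as (constructive) Dedekind cuts of ℚ.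
-- L x q  means  q < x ;  U x q  means  x < q.

record ℝ : Set₁ where
  field
    L U          : ℚ → Set
    L-inhabited  : ∃ λ q → L q
    U-inhabited  : ∃ λ q → U q
    L-rounded₁   : ∀ q → L q → ∃ λ r → q ℚ.< r × L r
    L-rounded₂   : ∀ q r → q ℚ.< r → L r → L q
    U-rounded₁   : ∀ r → U r → ∃ λ q → q ℚ.< r × U q
    U-rounded₂   : ∀ q r → q ℚ.< r → U q → U r
    disjoint     : ∀ q → ¬ (L q × U q)
    located      : ∀ q r → q ℚ.< r → L q ⊎ U r

num den : ℚ → ℕ
num q = ℤ.∣ ↥ q ∣
den q = ↧ₙ q

record Graph : Set where
  field
    n     : ℕ
    adj   : Fin n → Fin n → Bool
    sym   : ∀ u v → adj u v ≡ adj v u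
    irr   : ∀ u → adj u u ≡ false

data Reach {n : ℕ} (A : Fin n → Fin n → Bool) : Fin n → Fin n → Set where
  here : ∀ {u} → Reach A u u
  step : ∀ {u w v} → T (A u w) → Reach A w v → Reach A u v

Connected : {n : ℕ} → (Fin n → Fin n → Bool) → Set
Connected A = ∀ u v → Reach A u v

edges : Graph → ℕ
edges G = sum (map (λ u → sum (map (λ v →
            if ⌊ toℕ u ℕ.<? toℕ v ⌋ ∧ adj u v then 1 else 0)
            (allFin n))) (allFin n))
  where open Graph G

-- "edge density m/n < 1 + C n^(-ε)"   (C > 0 rational, ε real, n ≥ 1).
-- Since n^(-x) is continuous and non-increasing in x, this holds iff there is
-- a rational q = a/b > ε with  m/n < 1 + C n^(-a/b), i.e. (for C = Cn/Cd)
--   (m ∸ n)^b · n^a · Cd^b < n^b · Cn^b .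
DensityBelow : Graph → ℚ → ℝ → Set
DensityBelow G C ε = ∃ λ q → ℝ.U ε q × ℚ.Positive q ×
  ((m ∸ n) ^ den q * n ^ num q * den C ^ den q ℕ.< n ^ den q * num C ^ den q)
  where
  n = Graph.n G
  m = edges G

-- "k < c n^(1-ε)"   (c > 0 rational, ε real, n ≥ 1).
-- Equivalent to: some rational q = a/b > ε has k < c n^(1 - a/b), i.e.
-- (for c = cn/cd)   k^b · cd^b · n^a < cn^b · n^b .
AgentsBelow : ℕ → ℕ → ℚ → ℝ → Set
AgentsBelow n k c ε = ∃ λ q → ℝ.U ε q × ℚ.Positive q ×
  (k ^ den q * den c ^ den q * n ^ num q ℕ.< num c ^ den q * n ^ den q)

-- The Broadcast game.  Agents are Fin (suc k); agent zero is the source,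
-- the other k agents are ignorant.

module Game (G : Graph) (k : ℕ) where
  open Graph G

  Agent : Set
  Agent = Fin (suc k)

  record Config : Set where
    field
      pos      : Agent → Fin n
      informed : Agent → Bool
  open Config public

  -- a spanning connected subgraph (G minus the edges removed by the adversary)
  record Remaining : Set where
    field
      H    : Fin n → Fin n → Bool
      sub  : ∀ u v → T (H u v) → T (adj u v)
      hsym : ∀ u v → H u v ≡ H v u
      conn : Connected H
  open Remaining public

  Moves : Config → Remaining → Set
  Moves c R = (a : Agent) → Σ (Fin n) λ v → (v ≡ pos c a) ⊎ T (H R (pos c a) v)

  apply : (c : Config) (R : Remaining) → Moves c R → Config
  apply c R mv = record
    { pos      = newPos
    ; informed = λ a → informed c a ∨
        any (λ b → informed c b ∧ ⌊ newPos b Fin.≟ newPos a ⌋) (allFin (suc k))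
    }
    where
    newPos : Agent → Fin n
    newPos a = proj₁ (mv a)

  -- deterministic strategy with (joint) memory and full information
  record Strategy : Set₁ where
    field
      Mem  : Set
      init : Config → Mem
      move : Mem → (c : Config) → (R : Remaining) → Moves c R × Mem

  isSource : Agent → Bool
  isSource Fin.zero    = true
  isSource (Fin.suc _) = false

  initial : (Agent → Fin n) → Config
  initial p = record { pos = p ; informed = isSource }

  Adversary : Set
  Adversary = ℕ → Remaining

  run : (S : Strategy) → (Agent → Fin n) → Adversary → ℕ → Strategy.Mem S × Config
  run S p A zero    = Strategy.init S (initial p) , initial p
  run S p A (suc t) =
    let (mem , c) = run S p A t
        (mv , mem') = Strategy.move S mem c (A t)
    in mem' , apply c (A t) mv

  AllInformed : Config → Set
  AllInformed c = ∀ a → T (informed c a)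

  Solvable : Set₁
  Solvable = Σ Strategy λ S →
    (p : Agent → Fin n) → Injective _≡_ _≡_ p →
    (A : Adversary) → ∃ λ t → AllInformed (proj₂ (run S p A t))

BroadcastSolvable : Graph → ℕ → Set₁
BroadcastSolvable G k = Game.Solvable G k

-- The graphs are ladders: the path 0 — 1 — ⋯ — (n − 1) in which each of the first P squares
-- 3i, 3i + 1, 3i + 2, 3i + 3 is closed by the chord {3i, 3i + 3}, so there are at most
-- n + 3P edges.  Agent a starts on the middle edge {3a + 1, 3a + 2} of square a.  In every
-- round the adversary deletes, in the square of each agent, the outer edge at the agent's
-- vertex: the chord keeps the graph connected, and the agent can only move along its middle
-- edge.  Hence, as long as k < P, no ignorant agent ever meets the source.
-- Choosing n = 2^D and P = 2^(D − j − 2) with j/D < ε < (j + 2)/D makes the density less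
-- than 1 + 4 n^(−(j + 2)/D) and forces every k < n^(1 − j/D)/4 below P.  Such a j is found
-- by walking up the grid j/D, deciding by locatedness of the cut ε on which side of ε each
-- next grid point lies.

{-# OPTIONS --safe #-}
module Submission where

open import Defs
open import Data.Nat using (ℕ; _≤_)
open import Data.Rational using (ℚ; 0ℚ; 1ℚ; Positive)
open import Data.Product using (Σ; _×_)
open import Relation.Nullary using (¬_)

open import Data.Nat
  using ( zero; suc; _+_; _*_; _∸_; _^_; _<_; z≤n; s≤s; z<s; _≡ᵇ_; _<ᵇ_; _<?_; _≟_
        ; NonZero; >-nonZero)
open import Data.Nat.Properties
open import Data.Nat.Divisibility using (_∣_; _∣?_; n∣m*n; ∣m+n∣m⇒∣n; ∣m∣n⇒∣m+n; ∣-refl; ∣⇒≤)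
open import Data.Nat.Solver using (module +-*-Solver)
open import Data.Nat.ListAction using (sum)
open import Algebra.Properties.CommutativeSemigroup +-commutativeSemigroup
  using () renaming (interchange to +-interchange)
open import Algebra.Properties.CommutativeSemigroup *-commutativeSemigroup
  using () renaming (interchange to *-interchange)
open import Data.Bool using (Bool; true; false; T; _∧_; _∨_; if_then_else_)
open import Data.Bool.Properties using (∨-comm; T-∧; T-∨; T-≡)
open import Data.Maybe using (Maybe; just; nothing)
open import Data.Fin as Fin using (Fin; toℕ; fromℕ<)
open import Data.Fin.Properties using (toℕ-fromℕ<; fromℕ<-toℕ; toℕ<n; toℕ-injective)
open import Data.List using (allFin; tabulate; applyUpTo; map; _∷_)
open import Data.List.Properties using (map-tabulate)
open import Data.List.Relation.Unary.Any using (satisfied)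
open import Data.List.Relation.Unary.Any.Properties using (any⁻)
import Data.Integer as ℤ
open import Data.Integer using (+_)
open import Data.Integer.Properties using (pos-*; drop‿+<+; abs-*) renaming (*-comm to ℤ*-comm)
open import Data.Rational using (mkℚ; _/_; toℚᵘ) renaming (_<_ to _<ℚ_)
open import Data.Rational.Properties
  using (0/n≡0; normalize-pos; toℚᵘ-fromℚᵘ; fromℚᵘ-cong; toℚᵘ-mono-<; toℚᵘ-cancel-<)
  renaming (<-cmp to <ℚ-cmp)
open import Data.Rational.Unnormalised as ℚᵘ using (mkℚᵘ; *<*; *≡*)
open import Data.Rational.Unnormalised.Properties using (<-respˡ-≃; <-respʳ-≃; ≃-sym)
open import Data.Product using (∃; _,_; proj₁; proj₂)
import Data.Product as Product
open import Data.Sum using (_⊎_; inj₁; inj₂; [_,_]′)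
import Data.Sum as Sum
open import Data.Empty using (⊥-elim)
open import Function using (_∘_; id)
open import Function.Bundles using (module Equivalence)
open import Relation.Binary.Definitions using (tri<; tri≈; tri>)
open import Relation.Binary.PropositionalEquality
open import Relation.Nullary using (Dec; yes; no)
open import Relation.Nullary.Decidable using (⌊_⌋; toWitness; fromWitness)

open Equivalence using (to; from)

module _ {n : ℕ} {A : Fin n → Fin n → Bool} where

  Reach-trans : ∀ {u v w} → Reach A u v → Reach A v w → Reach A u w
  Reach-trans here       q = q
  Reach-trans (step e p) q = step e (Reach-trans p q)

  Reach-sym : (∀ u v → A u v ≡ A v u) → ∀ {u v} → Reach A u v → Reach A v u
  Reach-sym A-sym here = here
  Reach-sym A-sym {u} (step {w = w} e p) =
    Reach-trans (Reach-sym A-sym p) (step (subst T (A-sym u w) e) here)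

  all-reach⇒Connected : (∀ u v → A u v ≡ A v u) → (o : Fin n) → (∀ u → Reach A u o) →
                        Connected A
  all-reach⇒Connected A-sym o to-o u v = Reach-trans (to-o u) (Reach-sym A-sym (to-o v))

T-∧-⌊⌋ : ∀ b {A : Set} (a? : Dec A) → T (b ∧ ⌊ a? ⌋) → T b × A
T-∧-⌊⌋ true a? t = _ , toWitness t

restrict : (n : ℕ) → (ℕ → ℕ → Bool) → Fin n → Fin n → Bool
restrict n R u v = R (toℕ u) (toℕ v)

reach-step : ∀ {n} (R : ℕ → ℕ → Bool) {x y t} (x<n : x < n) (y<n : y < n) → T (R x y) →
             Reach (restrict n R) (fromℕ< y<n) t → Reach (restrict n R) (fromℕ< x<n) t
reach-step R x<n y<n e =
  step (subst₂ (λ a b → T (R a b)) (sym (toℕ-fromℕ< x<n)) (sym (toℕ-fromℕ< y<n)) e)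

-- Ladders

data Mod3 : ℕ → Set where
  corner : ∀ i → Mod3 (i * 3)
  inner₁ : ∀ i → Mod3 (1 + i * 3)
  inner₂ : ∀ i → Mod3 (2 + i * 3)

mod3 : ∀ x → Mod3 x
mod3 0 = corner 0
mod3 1 = inner₁ 0
mod3 2 = inner₂ 0
mod3 (suc (suc (suc x))) with mod3 x
... | corner i = corner (suc i)
... | inner₁ i = inner₁ (suc i)
... | inner₂ i = inner₂ (suc i)

3∤inner : ∀ {r} i → 0 < r → r < 3 → ¬ 3 ∣ r + i * 3
3∤inner {r} i 0<r r<3 3∣x = <⇒≱ r<3 (∣⇒≤ {{>-nonZero 0<r}}
  (∣m+n∣m⇒∣n (subst (3 ∣_) (+-comm r (i * 3)) 3∣x) (n∣m*n i)))

data Side : Set where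
  left right : Side

-- κ i ≡ just s: the outer edge of square i on side s is removed.  Square i has the
-- left outer edge {3i, 3i + 1}, the middle edge {3i + 1, 3i + 2} and the right outer
-- edge {3i + 2, 3i + 3}.
Cut : Set
Cut = ℕ → Maybe Side

uncut : Cut
uncut _ = nothing

keepsOuter : Side → Maybe Side → Bool
keepsOuter _     nothing      = true
keepsOuter left  (just left)  = false
keepsOuter left  (just right) = true
keepsOuter right (just left)  = true
keepsOuter right (just right) = false

pathKept : Cut → ℕ → Bool
pathKept κ 0                   = keepsOuter left (κ 0)
pathKept κ 1                   = true
pathKept κ 2                   = keepsOuter right (κ 0)
pathKept κ (suc (suc (suc x))) = pathKept (κ ∘ suc) x

pathKept-left : ∀ κ i → pathKept κ (i * 3) ≡ keepsOuter left (κ i)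
pathKept-left κ zero    = refl
pathKept-left κ (suc i) = pathKept-left (κ ∘ suc) i

pathKept-middle : ∀ κ i → T (pathKept κ (1 + i * 3))
pathKept-middle κ zero    = _
pathKept-middle κ (suc i) = pathKept-middle (κ ∘ suc) i

pathKept-right : ∀ κ i → pathKept κ (2 + i * 3) ≡ keepsOuter right (κ i)
pathKept-right κ zero    = refl
pathKept-right κ (suc i) = pathKept-right (κ ∘ suc) i

pathKept-uncut : ∀ x → T (pathKept uncut x)
pathKept-uncut 0                   = _
pathKept-uncut 1                   = _
pathKept-uncut 2                   = _
pathKept-uncut (suc (suc (suc x))) = pathKept-uncut x

chordAt : ℕ → ℕ → Bool
chordAt P x = (x <ᵇ P * 3) ∧ ⌊ 3 ∣? x ⌋

chordAt-corner : ∀ {P i} → i < P → T (chordAt P (i * 3))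
chordAt-corner {i = i} i<P = from T-∧ (<⇒<ᵇ (*-monoˡ-< 3 i<P) , fromWitness (n∣m*n i))

chordAt⇒3∣ : ∀ {P x} → T (chordAt P x) → 3 ∣ x
chordAt⇒3∣ {P} {x} = proj₂ ∘ T-∧-⌊⌋ (x <ᵇ P * 3) (3 ∣? x)

link : ℕ → Cut → ℕ → ℕ → Bool
link P κ x y = ((suc x ≡ᵇ y) ∧ pathKept κ x) ∨ (chordAt P x ∧ (3 + x ≡ᵇ y))

ladder : ℕ → Cut → ℕ → ℕ → Bool
ladder P κ x y = link P κ x y ∨ link P κ y x

ladder-sym : ∀ P κ x y → ladder P κ x y ≡ ladder P κ y x
ladder-sym P κ x y = ∨-comm (link P κ x y) (link P κ y x)

link-cases : ∀ P κ x y → T (link P κ x y) →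
             (y ≡ suc x × T (pathKept κ x)) ⊎ (T (chordAt P x) × y ≡ 3 + x)
link-cases P κ x y l =
  Sum.map (Product.map₁ (sym ∘ ≡ᵇ⇒≡ _ _) ∘ to T-∧) (Product.map₂ (sym ∘ ≡ᵇ⇒≡ _ _) ∘ to T-∧)
          (to (T-∨ {(suc x ≡ᵇ y) ∧ pathKept κ x}) l)

ladder-cases : ∀ P κ x y → T (ladder P κ x y) → T (link P κ x y) ⊎ T (link P κ y x)
ladder-cases P κ x y = to (T-∨ {link P κ x y} {link P κ y x})

link-increasing : ∀ P κ x y → T (link P κ x y) → x < y
link-increasing P κ x y l with link-cases P κ x y l
... | inj₁ (refl , _) = n<1+n x
... | inj₂ (_ , refl) = m<n+m x z<s

ladder-irrefl : ∀ P κ x → ladder P κ x x ≡ false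
ladder-irrefl P κ x with ladder P κ x x in e
... | false = refl
... | true  = ⊥-elim (<-irrefl refl
  ([ link-increasing P κ x x , link-increasing P κ x x ]′ (ladder-cases P κ x x (from T-≡ e))))

link-path : ∀ P κ x → T (pathKept κ x) → T (link P κ x (suc x))
link-path P κ x k = from T-∨ (inj₁ (from T-∧ (≡⇒≡ᵇ (suc x) (suc x) refl , k)))

link-chord : ∀ P κ x → T (chordAt P x) → T (link P κ x (3 + x))
link-chord P κ x c = from T-∨ (inj₂ (from T-∧ (c , ≡⇒≡ᵇ (3 + x) (3 + x) refl)))

ladder-fwd : ∀ P κ x y → T (link P κ x y) → T (ladder P κ x y)
ladder-fwd P κ x y = from (T-∨ {link P κ x y} {link P κ y x}) ∘ inj₁

ladder-bwd : ∀ P κ x y → T (link P κ y x) → T (ladder P κ x y)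
ladder-bwd P κ x y = from (T-∨ {link P κ x y} {link P κ y x}) ∘ inj₂

path-edge : ∀ P κ x → T (pathKept κ x) → T (ladder P κ x (suc x))
path-edge P κ x = ladder-fwd P κ x (suc x) ∘ link-path P κ x

path-edge⁻ : ∀ P κ x → T (pathKept κ x) → T (ladder P κ (suc x) x)
path-edge⁻ P κ x = ladder-bwd P κ (suc x) x ∘ link-path P κ x

chord-edge⁻ : ∀ P κ x → T (chordAt P x) → T (ladder P κ (3 + x) x)
chord-edge⁻ P κ x = ladder-bwd P κ (3 + x) x ∘ link-chord P κ x

link-uncut : ∀ P κ x y → T (link P κ x y) → T (link P uncut x y)
link-uncut P κ x y l with link-cases P κ x y l
... | inj₁ (refl , _) = link-path P uncut x (pathKept-uncut x)
... | inj₂ (c , refl) = link-chord P uncut x c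

ladder-uncut : ∀ P κ x y → T (ladder P κ x y) → T (ladder P uncut x y)
ladder-uncut P κ x y l =
  [ ladder-fwd P uncut x y ∘ link-uncut P κ x y , ladder-bwd P uncut x y ∘ link-uncut P κ y x ]′
    (ladder-cases P κ x y l)

ladder-inner : ∀ P κ {x y} → ¬ 3 ∣ x → T (ladder P κ x y) →
               (y ≡ suc x × T (pathKept κ x)) ⊎ (x ≡ suc y × T (pathKept κ y))
ladder-inner P κ {x} {y} 3∤x l with ladder-cases P κ x y l
... | inj₁ l₁ with link-cases P κ x y l₁
...   | inj₁ p       = inj₁ p
...   | inj₂ (c , _) = ⊥-elim (3∤x (chordAt⇒3∣ {P} {x} c))
ladder-inner P κ {x} {y} 3∤x l | inj₂ l₂ with link-cases P κ y x l₂
...   | inj₁ p          = inj₂ p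
...   | inj₂ (c , refl) = ⊥-elim (3∤x (∣m∣n⇒∣m+n ∣-refl (chordAt⇒3∣ {P} {y} c)))

trapped-left : ∀ P κ i {x y} → x ≡ 1 + i * 3 → κ i ≡ just left → T (ladder P κ x y) →
               y ≡ 2 + i * 3
trapped-left P κ i {y = y} refl κi l
  with ladder-inner P κ {1 + i * 3} {y} (3∤inner i (s≤s z≤n) (s≤s (s≤s z≤n))) l
... | inj₁ (y≡ , _)     = y≡
... | inj₂ (refl , kept) =
  ⊥-elim (subst T (trans (pathKept-left κ i) (cong (keepsOuter left) κi)) kept)

trapped-right : ∀ P κ i {x y} → x ≡ 2 + i * 3 → κ i ≡ just right → T (ladder P κ x y) →
                y ≡ 1 + i * 3
trapped-right P κ i {y = y} refl κi l
  with ladder-inner P κ {2 + i * 3} {y} (3∤inner i (s≤s z≤n) (s≤s (s≤s (s≤s z≤n)))) l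
... | inj₁ (refl , kept) =
  ⊥-elim (subst T (trans (pathKept-right κ i) (cong (keepsOuter right) κi)) kept)
... | inj₂ (x≡ , _)     = suc-injective (sym x≡)

module _ {n P : ℕ} (κ : Cut) (P*3<n : P * 3 < n) (κ-within : ∀ {i s} → κ i ≡ just s → i < P)
  where
  private
    A : Fin n → Fin n → Bool
    A = restrict n (ladder P κ)

    -- fromℕ< ignores its (irrelevant) bound, so hops built from different bound proofs chain.
    hop : ∀ {x y t} (x<n : x < n) (y<n : y < n) → T (ladder P κ x y) →
          Reach A (fromℕ< y<n) t → Reach A (fromℕ< x<n) t
    hop = reach-step (ladder P κ)

    below : ∀ {x} → suc x < n → x < n
    below = <-trans (n<1+n _)

    origin : Fin n
    origin = fromℕ< (≤-<-trans z≤n P*3<n)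

    corner-reaches : ∀ i (h : i * 3 < n) → Reach A (fromℕ< h) origin
    corner-reaches zero    h = here
    corner-reaches (suc i) h with κ i in κi | pathKept-left κ i | pathKept-right κ i
    ... | nothing | kl | kr =
      hop h h₂ (path-edge⁻ P κ (2 + i * 3) (from T-≡ kr))
        (hop h₂ h₁ (path-edge⁻ P κ (1 + i * 3) (pathKept-middle κ i))
          (hop h₁ h₀ (path-edge⁻ P κ (i * 3) (from T-≡ kl)) (corner-reaches i h₀)))
      where
      h₂ = below h
      h₁ = below h₂
      h₀ = below h₁
    ... | just _ | _ | _ = hop h h₀ (chord-edge⁻ P κ (i * 3) (chordAt-corner (κ-within κi)))
                             (corner-reaches i h₀)
      where
      h₀ = below (below (below h))

    via-left : ∀ i (h : 1 + i * 3 < n) → T (pathKept κ (i * 3)) → Reach A (fromℕ< h) origin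
    via-left i h kl = hop h (below h) (path-edge⁻ P κ (i * 3) kl) (corner-reaches i (below h))

    inner₁-reaches : ∀ i (h : 1 + i * 3 < n) → Reach A (fromℕ< h) origin
    inner₁-reaches i h with κ i in κi | pathKept-left κ i | pathKept-right κ i
    ... | nothing    | kl | _  = via-left i h (from T-≡ kl)
    ... | just right | kl | _  = via-left i h (from T-≡ kl)
    ... | just left  | _  | kr =
      hop h h₂ (path-edge P κ (1 + i * 3) (pathKept-middle κ i))
        (hop h₂ h₃ (path-edge P κ (2 + i * 3) (from T-≡ kr)) (corner-reaches (suc i) h₃))
      where
      h₃ : suc i * 3 < n
      h₃ = ≤-<-trans (*-monoˡ-≤ 3 (κ-within κi)) P*3<n
      h₂ = below h₃

    inner₂-reaches : ∀ i (h : 2 + i * 3 < n) → Reach A (fromℕ< h) origin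
    inner₂-reaches i h =
      hop h (below h) (path-edge⁻ P κ (1 + i * 3) (pathKept-middle κ i))
        (inner₁-reaches i (below h))

    reaches-origin : ∀ x (h : x < n) → Reach A (fromℕ< h) origin
    reaches-origin x h with mod3 x
    ... | corner i = corner-reaches i h
    ... | inner₁ i = inner₁-reaches i h
    ... | inner₂ i = inner₂-reaches i h

  ladder-connected : Connected (restrict n (ladder P κ))
  ladder-connected = all-reach⇒Connected (λ u v → ladder-sym P κ (toℕ u) (toℕ v)) origin
    λ u → subst (λ w → Reach A w origin) (fromℕ<-toℕ u (toℕ<n u))
                (reaches-origin (toℕ u) (toℕ<n u))

ladderGraph : ℕ → ℕ → Graph
ladderGraph n P = record
  { n   = n
  ; adj = restrict n (ladder P uncut)
  ; sym = λ u v → ladder-sym P uncut (toℕ u) (toℕ v)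
  ; irr = λ u → ladder-irrefl P uncut (toℕ u)
  }

-- Counting edges

𝟙 : Bool → ℕ
𝟙 b = if b then 1 else 0

𝟙-mono : ∀ {a b} → (T a → T b) → 𝟙 a ≤ 𝟙 b
𝟙-mono {false}         _ = z≤n
𝟙-mono {true}  {true}  _ = ≤-refl
𝟙-mono {true}  {false} f = ⊥-elim (f _)

𝟙-∨ : ∀ a b → 𝟙 (a ∨ b) ≤ 𝟙 a + 𝟙 b
𝟙-∨ true  _ = s≤s z≤n
𝟙-∨ false _ = ≤-refl

𝟙-∧ˡ : ∀ a b → 𝟙 (a ∧ b) ≤ 𝟙 a
𝟙-∧ˡ true  true  = ≤-refl
𝟙-∧ˡ true  false = z≤n
𝟙-∧ˡ false _     = z≤n

∑< : ℕ → (ℕ → ℕ) → ℕ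
∑< n f = sum (applyUpTo f n)

tabulate-toℕ : ∀ {A : Set} n (f : ℕ → A) → tabulate {n = n} (f ∘ toℕ) ≡ applyUpTo f n
tabulate-toℕ zero    f = refl
tabulate-toℕ (suc n) f = cong (f 0 ∷_) (tabulate-toℕ n (f ∘ suc))

sum-allFin : ∀ n (f : ℕ → ℕ) → sum (map (f ∘ toℕ) (allFin n)) ≡ ∑< n f
sum-allFin n f = cong sum (trans (map-tabulate id (f ∘ toℕ)) (tabulate-toℕ n f))

∑-mono : ∀ n {f g} → (∀ x → f x ≤ g x) → ∑< n f ≤ ∑< n g
∑-mono zero    f≤g = z≤n
∑-mono (suc n) f≤g = +-mono-≤ (f≤g 0) (∑-mono n (f≤g ∘ suc))

∑-distrib-+ : ∀ n f g → ∑< n (λ x → f x + g x) ≡ ∑< n f + ∑< n g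
∑-distrib-+ zero    f g = refl
∑-distrib-+ (suc n) f g = trans (cong (_+_ (f 0 + g 0)) (∑-distrib-+ n (f ∘ suc) (g ∘ suc)))
                                (+-interchange (f 0) (g 0) _ _)

∑-zero : ∀ n → ∑< n (λ _ → 0) ≡ 0
∑-zero zero    = refl
∑-zero (suc n) = ∑-zero n

∑-one : ∀ n → ∑< n (λ _ → 1) ≡ n
∑-one zero    = refl
∑-one (suc n) = cong suc (∑-one n)

∑-𝟙-≡ᵇ : ∀ n t → ∑< n (λ y → 𝟙 (t ≡ᵇ y)) ≤ 1
∑-𝟙-≡ᵇ zero    t       = z≤n
∑-𝟙-≡ᵇ (suc n) zero    = s≤s (≤-reflexive (∑-zero n))
∑-𝟙-≡ᵇ (suc n) (suc t) = ∑-𝟙-≡ᵇ n t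

∑-𝟙-∧-≡ᵇ : ∀ n c t → ∑< n (λ y → 𝟙 (c ∧ (t ≡ᵇ y))) ≤ 𝟙 c
∑-𝟙-∧-≡ᵇ n true  t = ∑-𝟙-≡ᵇ n t
∑-𝟙-∧-≡ᵇ n false t = ≤-reflexive (∑-zero n)

∑-𝟙-<ᵇ : ∀ n M → ∑< n (λ x → 𝟙 (x <ᵇ M)) ≤ M
∑-𝟙-<ᵇ zero    M       = z≤n
∑-𝟙-<ᵇ (suc n) zero    = ≤-reflexive (∑-zero n)
∑-𝟙-<ᵇ (suc n) (suc M) = s≤s (∑-𝟙-<ᵇ n M)

𝟙-forward : ∀ P κ x y → 𝟙 (⌊ x <? y ⌋ ∧ ladder P κ x y) ≤ 𝟙 (link P κ x y)
𝟙-forward P κ x y = 𝟙-mono {⌊ x <? y ⌋ ∧ ladder P κ x y} {link P κ x y} λ t →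
  let (x<y , l) = to (T-∧ {⌊ x <? y ⌋}) t
  in [ id , (λ l₂ → ⊥-elim (<-asym (toWitness {a? = x <? y} x<y) (link-increasing P κ y x l₂))) ]′
       (ladder-cases P κ x y l)

𝟙-link : ∀ P κ x y → 𝟙 (link P κ x y) ≤ 𝟙 (suc x ≡ᵇ y) + 𝟙 (chordAt P x ∧ (3 + x ≡ᵇ y))
𝟙-link P κ x y = ≤-trans (𝟙-∨ ((suc x ≡ᵇ y) ∧ pathKept κ x) (chordAt P x ∧ (3 + x ≡ᵇ y)))
                         (+-monoˡ-≤ _ (𝟙-∧ˡ (suc x ≡ᵇ y) (pathKept κ x)))

row-bound : ∀ n P κ x → ∑< n (λ y → 𝟙 (⌊ x <? y ⌋ ∧ ladder P κ x y)) ≤ 1 + 𝟙 (chordAt P x)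
row-bound n P κ x = begin
  ∑< n (λ y → 𝟙 (⌊ x <? y ⌋ ∧ ladder P κ x y))
    ≤⟨ ∑-mono n (λ y → ≤-trans (𝟙-forward P κ x y) (𝟙-link P κ x y)) ⟩
  ∑< n (λ y → 𝟙 (suc x ≡ᵇ y) + 𝟙 (chordAt P x ∧ (3 + x ≡ᵇ y)))
    ≡⟨ ∑-distrib-+ n _ _ ⟩
  ∑< n (λ y → 𝟙 (suc x ≡ᵇ y)) + ∑< n (λ y → 𝟙 (chordAt P x ∧ (3 + x ≡ᵇ y)))
    ≤⟨ +-mono-≤ (∑-𝟙-≡ᵇ n (suc x)) (∑-𝟙-∧-≡ᵇ n (chordAt P x) (3 + x)) ⟩
  1 + 𝟙 (chordAt P x) ∎
  where open ≤-Reasoning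

chords-bound : ∀ n P → ∑< n (λ x → 𝟙 (chordAt P x)) ≤ P * 3
chords-bound n P = ≤-trans (∑-mono n (λ x → 𝟙-∧ˡ (x <ᵇ P * 3) ⌊ 3 ∣? x ⌋)) (∑-𝟙-<ᵇ n (P * 3))

ladderGraph-edges : ∀ n P → edges (ladderGraph n P) ≤ n + P * 3
ladderGraph-edges n P = begin
  edges (ladderGraph n P)                           ≡⟨ sum-allFin n row ⟩
  ∑< n row                                          ≤⟨ ∑-mono n row≤ ⟩
  ∑< n (λ x → 1 + 𝟙 (chordAt P x))                  ≡⟨ ∑-distrib-+ n _ _ ⟩
  ∑< n (λ _ → 1) + ∑< n (λ x → 𝟙 (chordAt P x))    ≤⟨ +-mono-≤ (≤-reflexive (∑-one n))
                                                                  (chords-bound n P) ⟩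
  n + P * 3                                         ∎
  where
  open ≤-Reasoning
  forward : ℕ → ℕ → ℕ
  forward x y = 𝟙 (⌊ x <? y ⌋ ∧ ladder P uncut x y)
  row : ℕ → ℕ
  row x = sum (map (forward x ∘ toℕ) (allFin n))
  row≤ : ∀ x → row x ≤ 1 + 𝟙 (chordAt P x)
  row≤ x = ≤-trans (≤-reflexive (sum-allFin n (forward x))) (row-bound n P uncut x)

-- The trapping adversary

module Trap {n P k : ℕ} (P*3<n : P * 3 < n) (k<P : k < P) where
  open Game (ladderGraph n P) k

  home : Agent → ℕ
  home a = 1 + toℕ a * 3

  sideOf : Config → Agent → Side
  sideOf c a with toℕ (pos c a) ≟ home a
  ... | yes _ = left
  ... | no  _ = right

  trapCut : Config → Cut
  trapCut c i with i <? suc k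
  ... | yes i≤k = just (sideOf c (fromℕ< i≤k))
  ... | no  _   = nothing

  trapCut-agent : ∀ c a → trapCut c (toℕ a) ≡ just (sideOf c a)
  trapCut-agent c a with toℕ a <? suc k
  ... | yes a≤k = cong (just ∘ sideOf c) (fromℕ<-toℕ a a≤k)
  ... | no  a≰k = ⊥-elim (a≰k (toℕ<n a))

  trapCut-within : ∀ c {i s} → trapCut c i ≡ just s → i < P
  trapCut-within c {i} _ with i <? suc k
  trapCut-within c _  | yes i≤k = <-≤-trans i≤k k<P
  trapCut-within c () | no  _

  cut-home : ∀ c a → toℕ (pos c a) ≡ home a → trapCut c (toℕ a) ≡ just left
  cut-home c a at-home with toℕ (pos c a) ≟ home a | trapCut-agent c a
  ... | yes _      | cut = cut
  ... | no  ¬home | _   = ⊥-elim (¬home at-home)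

  cut-next : ∀ c a → toℕ (pos c a) ≡ suc (home a) → trapCut c (toℕ a) ≡ just right
  cut-next c a at-next with toℕ (pos c a) ≟ home a | trapCut-agent c a
  ... | yes at-home | _   = ⊥-elim (1+n≢n (trans (sym at-next) at-home))
  ... | no  _       | cut = cut

  trapping : Config → Remaining
  trapping c = record
    { H    = restrict n (ladder P (trapCut c))
    ; sub  = λ u v → ladder-uncut P (trapCut c) (toℕ u) (toℕ v)
    ; hsym = λ u v → ladder-sym P (trapCut c) (toℕ u) (toℕ v)
    ; conn = ladder-connected (trapCut c) P*3<n (trapCut-within c)
    }

  Confined : (Agent → Fin n) → Set
  Confined p = ∀ a → toℕ (p a) ≡ home a ⊎ toℕ (p a) ≡ suc (home a)

  confined-apart : ∀ {p} → Confined p → ∀ a → p Fin.zero ≢ p (Fin.suc a)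
  confined-apart conf a same =
    <-irrefl (cong toℕ same) (<-≤-trans (source<3 (conf Fin.zero)) (3≤ignorant (conf (Fin.suc a))))
    where
    source<3 : ∀ {x} → x ≡ 1 ⊎ x ≡ 2 → x < 3
    source<3 (inj₁ refl) = s≤s (s≤s z≤n)
    source<3 (inj₂ refl) = s≤s (s≤s (s≤s z≤n))
    3≤ignorant : ∀ {x} → x ≡ home (Fin.suc a) ⊎ x ≡ suc (home (Fin.suc a)) → 3 ≤ x
    3≤ignorant (inj₁ refl) = s≤s (s≤s (s≤s z≤n))
    3≤ignorant (inj₂ refl) = s≤s (s≤s (s≤s z≤n))

  step-confined : ∀ c → Confined (pos c) → (mv : Moves c (trapping c)) →
                  Confined (λ a → proj₁ (mv a))
  step-confined c conf mv a with conf a | proj₂ (mv a)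
  ... | inj₁ at-home | inj₁ stay = inj₁ (trans (cong toℕ stay) at-home)
  ... | inj₂ at-next | inj₁ stay = inj₂ (trans (cong toℕ stay) at-next)
  ... | inj₁ at-home | inj₂ edge =
    inj₂ (trapped-left P (trapCut c) (toℕ a) at-home (cut-home c a at-home) edge)
  ... | inj₂ at-next | inj₂ edge =
    inj₁ (trapped-right P (trapCut c) (toℕ a) at-next (cut-next c a at-next) edge)

  Invariant : Config → Set
  Invariant c = Confined (pos c) × (∀ a → ¬ T (informed c (Fin.suc a)))

  step-invariant : ∀ c → Invariant c → (mv : Moves c (trapping c)) →
                   Invariant (apply c (trapping c) mv)
  step-invariant c (conf , ignorant) mv = conf′ , ignorant′
    where
    conf′ : Confined (λ a → proj₁ (mv a))
    conf′ = step-confined c conf mv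
    moved : Agent → Fin n
    moved b = proj₁ (mv b)
    meeting : Fin k → Agent → Bool
    meeting a b = informed c b ∧ ⌊ moved b Fin.≟ moved (Fin.suc a) ⌋
    ignorant′ : ∀ a → ¬ T (informed (apply c (trapping c) mv) (Fin.suc a))
    ignorant′ a t with to T-∨ t
    ... | inj₁ was = ignorant a was
    ... | inj₂ met with satisfied (any⁻ (meeting a) (allFin (suc k)) met)
    ...   | Fin.zero  , meets =
      confined-apart conf′ a (proj₂ (T-∧-⌊⌋ (informed c Fin.zero) (moved Fin.zero Fin.≟ _) meets))
    ...   | Fin.suc b , meets =
      ignorant b (proj₁ (T-∧-⌊⌋ (informed c (Fin.suc b)) (moved (Fin.suc b) Fin.≟ _) meets))

  home<n : ∀ a → home a < n
  home<n a = <-trans (s≤s (s≤s (n≤1+n _)))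
                     (≤-<-trans (*-monoˡ-≤ 3 (<-≤-trans (toℕ<n a) k<P)) P*3<n)

  start : Agent → Fin n
  start a = fromℕ< (home<n a)

  start-injective : ∀ {a b} → start a ≡ start b → a ≡ b
  start-injective {a} {b} e = toℕ-injective (*-cancelʳ-≡ (toℕ a) (toℕ b) 3 (suc-injective
    (trans (sym (toℕ-fromℕ< (home<n a))) (trans (cong toℕ e) (toℕ-fromℕ< (home<n b))))))

  -- The adversary adapts to the play, so it is obtained by running the strategy against it.
  module Against (S : Strategy) where
    open Strategy S

    history : ℕ → Mem × Config
    history zero    = init (initial start) , initial start
    history (suc t) =
      let (mem , c) = history t
          (mv , mem′) = move mem c (trapping c)
      in mem′ , apply c (trapping c) mv

    adversary : Adversary
    adversary t = trapping (proj₂ (history t))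

    run≡history : ∀ t → run S start adversary t ≡ history t
    run≡history zero = refl
    run≡history (suc t) rewrite run≡history t = refl

    invariant : ∀ t → Invariant (proj₂ (history t))
    invariant zero    = (λ a → inj₁ (toℕ-fromℕ< (home<n a))) , λ a ()
    invariant (suc t) = step-invariant c (invariant t) (proj₁ (move mem c (trapping c)))
      where
      mem = proj₁ (history t)
      c   = proj₂ (history t)

  unsolvable : 1 ≤ k → ¬ Solvable
  unsolvable 1≤k (S , wins) =
    let (t , all-informed) = wins start start-injective adversary
    in proj₂ (invariant t) ignorant
         (subst (λ r → T (informed (proj₂ r) (Fin.suc ignorant))) (run≡history t)
                (all-informed (Fin.suc ignorant)))
    where
    open Against S
    ignorant : Fin k
    ignorant = fromℕ< 1≤k

-- Locating a real number on a grid

module _ (x : ℝ) where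
  open ℝ x

  L<U : ∀ {p q} → L p → U q → p <ℚ q
  L<U {p} {q} lp uq with <ℚ-cmp p q
  ... | tri< p<q _ _ = p<q
  ... | tri≈ _ refl _ = ⊥-elim (disjoint p (lp , uq))
  ... | tri> _ _ q<p = ⊥-elim (disjoint p (lp , U-rounded₂ q p q<p uq))

  cut-crossing : (g : ℕ → ℚ) → (∀ j → g j <ℚ g (suc j)) → ∀ m → L (g 0) → U (g (2 + m)) →
                 ∃ λ j → j ≤ m × L (g j) × U (g (2 + j))
  cut-crossing g g-inc zero    l u = 0 , z≤n , l , u
  cut-crossing g g-inc (suc m) l u with located (g 1) (g 2) (g-inc 1)
  ... | inj₂ u₂ = 0 , z≤n , l , u₂
  ... | inj₁ l₁ =
    let (j , j≤m , lj , uj) = cut-crossing (g ∘ suc) (g-inc ∘ suc) m l₁ u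
    in suc j , s≤s j≤m , lj , uj

grid-< : ∀ d {i j} → i < j → + i / suc d <ℚ + j / suc d
grid-< d {i} {j} i<j = toℚᵘ-cancel-<
  (<-respʳ-≃ (≃-sym (toℚᵘ-fromℚᵘ (mkℚᵘ (+ j) d)))
    (<-respˡ-≃ (≃-sym (toℚᵘ-fromℚᵘ (mkℚᵘ (+ i) d)))
      (*<* (subst₂ ℤ._<_ (pos-* i (suc d)) (pos-* j (suc d)) (ℤ.+<+ (*-monoˡ-< (suc d) i<j))))))

grid-top : ∀ d → + suc d / suc d ≡ 1ℚ
grid-top d = fromℚᵘ-cong {mkℚᵘ (+ suc d) d} {ℚᵘ.1ℚᵘ} (*≡* (ℤ*-comm (+ suc d) (+ 1)))

≃-num-den : ∀ q {j d} → toℚᵘ q ℚᵘ.≃ mkℚᵘ (+ j) d → num q * suc d ≡ j * den q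
≃-num-den (mkℚ i b _) {j} {d} (*≡* eq) =
  trans (sym (abs-* i (+ suc d))) (trans (cong ℤ.∣_∣ eq) (abs-* (+ j) (+ suc b)))

grid-num-den : ∀ j d → num (+ j / suc d) * suc d ≡ j * den (+ j / suc d)
grid-num-den j d = ≃-num-den (+ j / suc d) (toℚᵘ-fromℚᵘ (mkℚᵘ (+ j) d))

grid<⇒ : ∀ {j d} q → Positive q → + j / suc d <ℚ q → j * den q < num q * suc d
grid<⇒ {j} {d} (mkℚ (+ a) b _) _ j/d<q
  with <-respˡ-≃ (toℚᵘ-fromℚᵘ (mkℚᵘ (+ j) d)) (toℚᵘ-mono-< j/d<q)
... | *<* lt = drop‿+<+ (subst₂ ℤ._<_ (sym (pos-* j (suc b))) (sym (pos-* a (suc d))) lt)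

grid-crossing : (ε : ℝ) → ℝ.L ε 0ℚ → ℝ.U ε 1ℚ → ∀ d →
                ∃ λ j → j ≤ d × ℝ.L ε (+ j / (2 + d)) × ℝ.U ε (+ (2 + j) / (2 + d))
grid-crossing ε l₀ u₁ d =
  cut-crossing ε (λ j → + j / (2 + d)) (λ j → grid-< (suc d) (n<1+n j)) d
    (subst (ℝ.L ε) (sym (0/n≡0 (2 + d))) l₀) (subst (ℝ.U ε) (sym (grid-top (suc d))) u₁)

-- Powers of two

^-distribʳ-* : ∀ m n o → (m * n) ^ o ≡ m ^ o * n ^ o
^-distribʳ-* m n zero    = refl
^-distribʳ-* m n (suc o) =
  trans (cong (m * n *_) (^-distribʳ-* m n o)) (*-interchange m n (m ^ o) (n ^ o))

n<2^n : ∀ n → n < 2 ^ n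
n<2^n zero    = s≤s z≤n
n<2^n (suc n) = begin-strict
  1 + n          <⟨ +-mono-≤-< (m^n>0 2 n) (n<2^n n) ⟩
  2 ^ n + 2 ^ n  ≡⟨ cong (_+_ (2 ^ n)) (sym (+-identityʳ (2 ^ n))) ⟩
  2 ^ suc n      ∎
  where open ≤-Reasoning

squares-fit : ∀ {s} e → 2 ≤ s → 2 ^ e * 3 < 2 ^ (s + e)
squares-fit {s} e 2≤s = begin-strict
  2 ^ e * 3     <⟨ *-monoʳ-< (2 ^ e) {{m^n≢0 2 e}} (n<1+n 3) ⟩
  2 ^ e * 2 ^ 2 ≤⟨ *-monoʳ-≤ (2 ^ e) (^-monoʳ-≤ 2 2≤s) ⟩
  2 ^ e * 2 ^ s ≡⟨ *-comm (2 ^ e) (2 ^ s) ⟩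
  2 ^ s * 2 ^ e ≡⟨ ^-distribˡ-+-* 2 s e ⟨
  2 ^ (s + e)   ∎
  where open ≤-Reasoning

density-bound : ∀ {x s e D a b} .{{_ : NonZero b}} → s + e ≡ D → a * D ≡ s * b →
                x ≤ 2 ^ e * 3 → x ^ b * (2 ^ D) ^ a * 1 ^ b < (2 ^ D) ^ b * 4 ^ b
density-bound {x} {s} {e} {_} {a} {b} refl aD≡sb x≤ = begin-strict
  x ^ b * (2 ^ (s + e)) ^ a * 1 ^ b ≡⟨ cong₂ (λ u v → x ^ b * u * v) n^a≡ (^-zeroˡ b) ⟩
  x ^ b * (2 ^ s) ^ b * 1           ≡⟨ *-identityʳ _ ⟩
  x ^ b * (2 ^ s) ^ b               ≡⟨ ^-distribʳ-* x (2 ^ s) b ⟨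
  (x * 2 ^ s) ^ b                   <⟨ ^-monoˡ-< b base< ⟩
  (2 ^ (s + e) * 4) ^ b             ≡⟨ ^-distribʳ-* (2 ^ (s + e)) 4 b ⟩
  (2 ^ (s + e)) ^ b * 4 ^ b         ∎
  where
  open ≤-Reasoning
  open +-*-Solver
  n^a≡ : (2 ^ (s + e)) ^ a ≡ (2 ^ s) ^ b
  n^a≡ = begin-equality
    (2 ^ (s + e)) ^ a ≡⟨ ^-*-assoc 2 (s + e) a ⟩
    2 ^ ((s + e) * a) ≡⟨ cong (2 ^_) (trans (*-comm (s + e) a) aD≡sb) ⟩
    2 ^ (s * b)       ≡⟨ ^-*-assoc 2 s b ⟨
    (2 ^ s) ^ b       ∎
  base< : x * 2 ^ s < 2 ^ (s + e) * 4
  base< = begin-strict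
    x * 2 ^ s         ≤⟨ *-monoˡ-≤ (2 ^ s) x≤ ⟩
    2 ^ e * 3 * 2 ^ s <⟨ *-monoˡ-< (2 ^ s) {{m^n≢0 2 s}}
                           (*-monoʳ-< (2 ^ e) {{m^n≢0 2 e}} (n<1+n 3)) ⟩
    2 ^ e * 4 * 2 ^ s ≡⟨ solve 2 (λ p q → q :* con 4 :* p := p :* q :* con 4) refl
                           (2 ^ s) (2 ^ e) ⟩
    2 ^ s * 2 ^ e * 4 ≡⟨ cong (_* 4) (^-distribˡ-+-* 2 s e) ⟨
    2 ^ (s + e) * 4   ∎

agents-bound : ∀ {k j e D a b} .{{_ : NonZero b}} → 2 + j + e ≡ D → j * b < a * D →
               k ^ b * 4 ^ b * (2 ^ D) ^ a < 1 ^ b * (2 ^ D) ^ b → k < 2 ^ e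
agents-bound {k} {j} {e} {_} {a} {b} refl jb<aD below =
  ≰⇒> λ 2^e≤k → <⇒≱ below (begin
    1 ^ b * (2 ^ D) ^ b               ≡⟨ cong (_* (2 ^ D) ^ b) (^-zeroˡ b) ⟩
    1 * (2 ^ D) ^ b                   ≡⟨ *-identityˡ _ ⟩
    (2 ^ D) ^ b                       ≡⟨ cong (_^ b) n≡ ⟩
    (2 ^ e * 4 * 2 ^ j) ^ b           ≡⟨ ^-distribʳ-* (2 ^ e * 4) (2 ^ j) b ⟩
    (2 ^ e * 4) ^ b * (2 ^ j) ^ b     ≡⟨ cong (_* (2 ^ j) ^ b) (^-distribʳ-* (2 ^ e) 4 b) ⟩
    (2 ^ e) ^ b * 4 ^ b * (2 ^ j) ^ b ≤⟨ *-mono-≤ (*-monoˡ-≤ (4 ^ b) (^-monoˡ-≤ b 2^e≤k)) 2^jb≤ ⟩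
    k ^ b * 4 ^ b * (2 ^ D) ^ a       ∎)
  where
  open ≤-Reasoning
  open +-*-Solver
  D = 2 + j + e
  n≡ : 2 ^ D ≡ 2 ^ e * 4 * 2 ^ j
  n≡ = trans (^-distribˡ-+-* 2 (2 + j) e)
             (solve 2 (λ p q → con 2 :* (con 2 :* p) :* q := q :* con 4 :* p) refl (2 ^ j) (2 ^ e))
  2^jb≤ : (2 ^ j) ^ b ≤ (2 ^ D) ^ a
  2^jb≤ = begin
    (2 ^ j) ^ b ≡⟨ ^-*-assoc 2 j b ⟩
    2 ^ (j * b) ≤⟨ ^-monoʳ-≤ 2 (≤-trans (<⇒≤ jb<aD) (≤-reflexive (*-comm a D))) ⟩
    2 ^ (D * a) ≡⟨ ^-*-assoc 2 D a ⟨
    (2 ^ D) ^ a ∎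

HardInstance : ℚ → ℚ → ℝ → ℕ → Set₁
HardInstance C c ε N = Σ Graph λ G → N ≤ Graph.n G × Connected (Graph.adj G) ×
  DensityBelow G C ε ×
  ((k : ℕ) → 1 ≤ k → AgentsBelow (Graph.n G) k c ε → ¬ BroadcastSolvable G k)

ladder-hard : ∀ ε d j → j ≤ d → ℝ.L ε (+ j / (2 + d)) → ℝ.U ε (+ (2 + j) / (2 + d)) →
              HardInstance (+ 4 / 1) (+ 1 / 4) ε d
ladder-hard ε d j j≤d lj uj =
  ladderGraph n P , d≤n , ladder-connected {n} {P} uncut P*3<n (λ ()) , sparse , unsolvable
  where
  e = d ∸ j
  n = 2 ^ (2 + d)
  P = 2 ^ e
  D≡ : 2 + j + e ≡ 2 + d
  D≡ = cong (_+_ 2) (m+[n∸m]≡n j≤d)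
  d≤n : d ≤ n
  d≤n = ≤-trans (m≤n+m d 2) (<⇒≤ (n<2^n (2 + d)))
  P*3<n : P * 3 < n
  P*3<n = subst (λ D → P * 3 < 2 ^ D) D≡ (squares-fit {2 + j} e (s≤s (s≤s z≤n)))
  q₂ = + (2 + j) / (2 + d)
  sparse : DensityBelow (ladderGraph n P) (+ 4 / 1) ε
  sparse = q₂ , uj , normalize-pos (2 + j) (2 + d) ,
           density-bound {s = 2 + j} {e} {a = num q₂} {den q₂} D≡ (grid-num-den (2 + j) (suc d))
             (m≤n+o⇒m∸n≤o _ n (ladderGraph-edges n P))
  unsolvable : ∀ k → 1 ≤ k → AgentsBelow n k (+ 1 / 4) ε → ¬ BroadcastSolvable (ladderGraph n P) k
  unsolvable k 1≤k (q , uq , q>0 , below) = Trap.unsolvable {n} {P} {k} P*3<n k<P 1≤k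
    where
    k<P : k < P
    k<P = agents-bound {k} {j} {e} {a = num q} {den q} D≡
            (grid<⇒ {j} {suc d} q q>0 (L<U ε lj uq)) below

corollary6 : (ε : ℝ) → ℝ.L ε 0ℚ → ℝ.U ε 1ℚ →
    Σ ℚ λ C → Positive C × Σ ℚ λ c → Positive c ×
      ((N : ℕ) → Σ Graph λ G → N ≤ Graph.n G × Connected (Graph.adj G) ×
        DensityBelow G C ε ×
        ((k : ℕ) → 1 ≤ k → AgentsBelow (Graph.n G) k c ε → ¬ BroadcastSolvable G k))
corollary6 ε 0<ε ε<1 = + 4 / 1 , _ , + 1 / 4 , _ , λ N →
  let (j , j≤N , lj , uj) = grid-crossing ε 0<ε ε<1 N
  in ladder-hard ε N j j≤N lj uj
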